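{- Let $G$ be a finite group and $H$ a non-trivial normal subgroup of $G$. Let $\kappa$ and $\tau$ be integers satisfying $0\leq\kappa\leq|H|-1$, $1\leq\tau\leq|H|$ and $\gcd(2,|H|-1)\mid\kappa$. Then: (i) if $\tau$ is even, then $H$ is a $(\kappa,\tau)$-regular set of $G$; (ii) if $\tau$ is odd, then $H$ is a $(\kappa,\tau)$-regular set of $G$ if and only if $H$ is a perfect code of $G$.
   Context: All graphs are finite, undirected and simple. For a finite group $G$ and an inverse-closed subset $X\subseteq G\setminus\{1\}$, the Cayley graph $\mathrm{Cay}(G,X)$ has vertex set $G$ and edge set $\{\{g,gx\}: g\in G, x\in X\}$. For nonnegative integers $\kappa,\tau$, a subset $R$ of the vertex set of a graph $\Gamma$ is a $(\kappa,\tau)$-regular set of $\Gamma$ if every vertex in $R$ is adjacent to exactly $\kappa$ vertices of $R$ and every vertex outside $R$ is adjacent to exactly $\tau$ vertices of $R$. A subset $R\subseteq G$ is a $(\kappa,\tau)$-regular set of $G$ if there is a Cayley graph $\Gamma$ on $G$ such that $R$ is a $(\kappa,\tau)$-regular set of $\Gamma$. A perfect code of $G$ here means a $(0,1)$-regular set of $G$ (equivalently, a subset $C$ of $G$ such that there is an inverse-closed subset $Y\ni 1$ of $G$ with every $g\in G$ expressible uniquely as $g=cy$ with $c\in C$, $y\in Y$). -}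

module Defs where

open import Data.Nat using (ℕ; _∸_; _≤_)
open import Data.Fin using (Fin)
open import Data.Fin.Subset using (Subset; _∈_; _∉_; _∩_; ∣_∣; ⁅_⁆)
open import Data.Vec using (tabulate; lookup)
open import Data.Product using (Σ; _×_; ∃)
open import Relation.Binary.PropositionalEquality using (_≡_)
open import Relation.Nullary using (¬_)
open import Algebra.Structures using (IsGroup)

-- A finite group: carrier Fin order, with propositional equality.
-- (Every finite group is isomorphic to one of this form.)
record FiniteGroup : Set where
  field
    order   : ℕ
    _∙_     : Fin order → Fin order → Fin order
    ε       : Fin order
    _⁻¹     : Fin order → Fin order
    isGroup : IsGroup _≡_ _∙_ ε _⁻¹

module _ (G : FiniteGroup) where
  open FiniteGroup G

  Elt : Set
  Elt = Fin order

  record IsNormalSubgroup (H : Subset order) : Set where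
    field
      ε∈      : ε ∈ H
      ∙-closed : ∀ {a b} → a ∈ H → b ∈ H → (a ∙ b) ∈ H
      ⁻¹-closed : ∀ {a} → a ∈ H → (a ⁻¹) ∈ H
      conj-closed : ∀ g {h} → h ∈ H → ((g ∙ h) ∙ (g ⁻¹)) ∈ H

  NonTrivial : Subset order → Set
  NonTrivial H = Σ Elt (λ h → h ∈ H × ¬ (h ≡ ε))

  record IsConnectionSet (X : Subset order) : Set where
    field
      ε∉X      : ε ∉ X
      inv-closed : ∀ {x} → x ∈ X → (x ⁻¹) ∈ X

  -- Neighbourhood of g in Cay(G,X): { y | y = g x, x ∈ X } = { y | g⁻¹ y ∈ X }
  nbhd : Subset order → Elt → Subset order
  nbhd X g = tabulate (λ y → lookup X ((g ⁻¹) ∙ y))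

  IsRegularSetOfCay : ℕ → ℕ → Subset order → Subset order → Set
  IsRegularSetOfCay κ τ X R =
    ∀ g → (g ∈ R → ∣ R ∩ nbhd X g ∣ ≡ κ) × (g ∉ R → ∣ R ∩ nbhd X g ∣ ≡ τ)

  IsRegularSet : ℕ → ℕ → Subset order → Set
  IsRegularSet κ τ R = Σ (Subset order) (λ X → IsConnectionSet X × IsRegularSetOfCay κ τ X R)

  IsPerfectCode : Subset order → Set
  IsPerfectCode R = IsRegularSet 0 1 R

-- For an inverse-closed X, the neighbours of g in Cay(G, X) lying in H are g(X ∩ g⁻¹H), so H is a
-- (κ,τ)-regular set exactly when X meets H in κ elements and every other coset in τ elements.
-- Inversion maps the coset rH onto r⁻¹H, hence X can be chosen separately on each pair rH ∪ r⁻¹H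
-- (through a representative of the pair), as an inverse-closed subset of prescribed size:
--   * in H ∖ {1}, of size κ;
--   * in a self-inverse coset rH ≠ H (r² ∈ H), of size τ;
--   * in rH ∪ r⁻¹H with r² ∉ H, of size 2τ, which inversion splits evenly between the two cosets.
-- An inverse-closed set has such subsets of every size up to its own, except odd sizes when it
-- contains no self-inverse element; and an inverse-closed set without self-inverse elements has
-- even size. This makes κ harmless under the gcd condition, τ harmless when even, and shows that
-- for odd τ both (κ,τ)-regularity and being a perfect code (τ = 1) are equivalent to every
-- self-inverse coset rH ≠ H containing an involution.

module Submission where

open import Algebra.Bundles using (Group)
import Algebra.Properties.Group as GroupProperties
open import Algebra.Structures using (IsGroup)
open import Data.Bool using (Bool; true; false; T; _∧_; _∨_; not; if_then_else_)
open import Data.Bool.Properties using (∨-comm; ∨-idem; ∧-comm; ∧-zeroʳ; T-∧; T-∨; T-≡)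
open import Data.Empty using (⊥-elim)
open import Data.Fin using (Fin; zero; suc)
open import Data.Fin.Permutation using (permutation)
open import Data.Fin.Properties using (_≟_; any?)
open import Data.Fin.Subset as Subset using (Subset; ∣_∣; _∈_)
open import Data.Maybe using (Maybe; just; nothing; fromMaybe)
import Data.Maybe as Maybe
open import Data.Nat using (ℕ; zero; suc; _+_; _*_; _∸_; _≤_; _<_; s≤s; z≤n; s≤s⁻¹)
open import Data.Nat.Divisibility using (_∣_; _∣?_; _∣0; ∣-refl; ∣-trans; m∣m*n; ∣1⇒≡1; ∣m∣n⇒∣m+n; ∣m+n∣m⇒∣n)
open import Data.Nat.GCD using (gcd; gcd-greatest)
open import Data.Nat.Properties using (+-0-commutativeMonoid; suc-injective; ≤-trans; >⇒≢; +-identityʳ; *-cancelˡ-≡; *-monoʳ-≤)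
open import Data.Product using (∃; _×_; _,_; proj₁; proj₂)
open import Data.Sum using (_⊎_; inj₁; inj₂; [_,_])
import Data.Sum as Sum
open import Data.Vec using ([]; _∷_; lookup; tabulate)
open import Data.Vec.Properties using ([]=⇒lookup; lookup⇒[]=; lookup-zipWith; lookup∘tabulate)
open import Function using (_∘_; _⇔_; mk⇔; Equivalence)
open import Level using (0ℓ)
open import Relation.Binary.PropositionalEquality using (_≡_; _≢_; refl; sym; trans; cong; cong₂; subst; module ≡-Reasoning)
open import Relation.Nullary using (¬_; Dec; yes; no; contradiction)
open import Relation.Nullary.Decidable using (does; T?; ¬?; _×-dec_; dec-true; does-⇔; decidable-stable)
open import Algebra.Properties.CommutativeMonoid.Sum +-0-commutativeMonoid
  using (sum; sum-cong-≗; ∑-distrib-+; sum-permute)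

open import Defs

T-antisym : ∀ {a b} → (T a → T b) → (T b → T a) → a ≡ b
T-antisym {false} {false} _ _ = refl
T-antisym {false} {true}  _ b⇒a = ⊥-elim (b⇒a _)
T-antisym {true}  {false} a⇒b _ = ⊥-elim (a⇒b _)
T-antisym {true}  {true}  _ _ = refl

¬T⇒≡false : ∀ {b} → ¬ T b → b ≡ false
¬T⇒≡false {false} _ = refl
¬T⇒≡false {true}  ¬t = ⊥-elim (¬t _)

∧-congˡ-T : ∀ {a b c} → (T a → b ≡ c) → a ∧ b ≡ a ∧ c
∧-congˡ-T {false} _   = refl
∧-congˡ-T {true}  b≡c = b≡c _

T-lookup : ∀ {n} {p : Subset n} {x} → x ∈ p → T (lookup p x)
T-lookup = Equivalence.from T-≡ ∘ []=⇒lookup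

lookup-∈ : ∀ {n} {p : Subset n} {x} → T (lookup p x) → x ∈ p
lookup-∈ {p = p} {x} = lookup⇒[]= x p ∘ Equivalence.to T-≡

∈-tabulate : ∀ {n} {f : Fin n → Bool} {x} → x ∈ tabulate f → T (f x)
∈-tabulate {f = f} {x} = subst T (lookup∘tabulate f x) ∘ T-lookup

tabulate-∈ : ∀ {n} {f : Fin n → Bool} {x} → T (f x) → x ∈ tabulate f
tabulate-∈ {f = f} {x} = lookup-∈ ∘ subst T (sym (lookup∘tabulate f x))

¬2∣1 : ¬ 2 ∣ 1
¬2∣1 2∣1 = contradiction (∣1⇒≡1 2∣1) λ ()

T-does⇒ : ∀ {p} {P : Set p} (P? : Dec P) → T (does P?) → P
T-does⇒ (yes p) _ = p

module _ {n : ℕ} where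

  infixr 7 _∩_
  infixr 6 _∪_ _∖_
  infix 4 _⊆_

  _∩_ _∪_ _∖_ : (Fin n → Bool) → (Fin n → Bool) → (Fin n → Bool)
  (A ∩ B) x = A x ∧ B x
  (A ∪ B) x = A x ∨ B x
  (A ∖ B) x = A x ∧ not (B x)

  _⊆_ : (Fin n → Bool) → (Fin n → Bool) → Set
  B ⊆ A = ∀ x → T (B x) → T (A x)

  ⁅_⁆ : Fin n → (Fin n → Bool)
  ⁅ a ⁆ x = does (x ≟ a)

  ∪-⊆ : ∀ {A} B C → B ⊆ A → C ⊆ A → B ∪ C ⊆ A
  ∪-⊆ B C B⊆A C⊆A x = [ B⊆A x , C⊆A x ] ∘ Equivalence.to (T-∨ {B x})

  ∖-⊆ : ∀ A B → A ∖ B ⊆ A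
  ∖-⊆ A B x = proj₁ ∘ Equivalence.to (T-∧ {A x})

  ∖-∈ : ∀ A B {x} → T (A x) → ¬ T (B x) → T ((A ∖ B) x)
  ∖-∈ A B {x} x∈A x∉B rewrite ¬T⇒≡false x∉B = Equivalence.from T-∧ (x∈A , _)

  ∖-disjoint : ∀ A B {x} → T ((A ∖ B) x) → ¬ T (B x)
  ∖-disjoint A B {x} x∈A∖B x∈B with B x
  ... | true = proj₂ (Equivalence.to (T-∧ {A x}) x∈A∖B)

boolToℕ : Bool → ℕ
boolToℕ false = 0
boolToℕ true  = 1

count : ∀ {n} → (Fin n → Bool) → ℕ
count A = sum (boolToℕ ∘ A)

∣p∣≡count : ∀ {n} (p : Subset n) → ∣ p ∣ ≡ count (lookup p)
∣p∣≡count []          = refl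
∣p∣≡count (true ∷ p)  = cong suc (∣p∣≡count p)
∣p∣≡count (false ∷ p) = ∣p∣≡count p

count-cong : ∀ {n} {A B : Fin n → Bool} → (∀ x → A x ≡ B x) → count A ≡ count B
count-cong A≗B = sum-cong-≗ (cong boolToℕ ∘ A≗B)

count-∅ : ∀ n → count {n} (λ _ → false) ≡ 0
count-∅ zero    = refl
count-∅ (suc n) = count-∅ n

count-empty : ∀ {n} {A : Fin n → Bool} → (∀ x → ¬ T (A x)) → count A ≡ 0
count-empty {n} A-empty = trans (count-cong (¬T⇒≡false ∘ A-empty)) (count-∅ n)

count-nonempty : ∀ {n} (A : Fin n → Bool) → 0 < count A → ∃ λ a → T (A a)
count-nonempty A 0<count with any? (T? ∘ A)
... | yes a∈A = a∈A
... | no  ∄a  = contradiction (count-empty (λ x x∈A → ∄a (x , x∈A))) (>⇒≢ 0<count)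

count-⁅⁆ : ∀ {n} (a : Fin n) → count ⁅ a ⁆ ≡ 1
count-⁅⁆ {suc n} zero    = cong suc (count-∅ n)
count-⁅⁆ {suc n} (suc a) = count-⁅⁆ a

count-partition : ∀ {n} (A B : Fin n → Bool) → count A ≡ count (A ∩ B) + count (A ∖ B)
count-partition A B =
  trans (sum-cong-≗ (λ x → split (A x) (B x))) (∑-distrib-+ (boolToℕ ∘ (A ∩ B)) (boolToℕ ∘ (A ∖ B)))
  where
    split : ∀ a b → boolToℕ a ≡ boolToℕ (a ∧ b) + boolToℕ (a ∧ not b)
    split false _     = refl
    split true  false = refl
    split true  true  = refl

count-∪ : ∀ {n} (A B : Fin n → Bool) → (∀ x → T (A x) → ¬ T (B x)) →
          count (A ∪ B) ≡ count A + count B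
count-∪ A B disjoint =
  trans (sum-cong-≗ (λ x → split (disjoint x))) (∑-distrib-+ (boolToℕ ∘ A) (boolToℕ ∘ B))
  where
    split : ∀ {a b} → (T a → ¬ T b) → boolToℕ (a ∨ b) ≡ boolToℕ a + boolToℕ b
    split {false} _ = refl
    split {true} {false} _ = refl
    split {true} {true} a⇒¬b = ⊥-elim (a⇒¬b _ _)

count-∩-⊆ : ∀ {n} (A B : Fin n → Bool) → B ⊆ A → count (A ∩ B) ≡ count B
count-∩-⊆ A B B⊆A = count-cong λ x →
  T-antisym (proj₂ ∘ Equivalence.to (T-∧ {A x})) (λ x∈B → Equivalence.from T-∧ (B⊆A x x∈B , x∈B))

count-⊆-∪ : ∀ {n} (B C D : Fin n → Bool) → B ⊆ C ∪ D → (∀ x → T (C x) → ¬ T (D x)) →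
            count B ≡ count (C ∩ B) + count (D ∩ B)
count-⊆-∪ B C D B⊆C∪D disjoint =
  trans (count-partition B C) (cong₂ _+_ (count-cong λ x → ∧-comm (B x) (C x))
                                          (count-cong λ x → split (B⊆C∪D x) (disjoint x)))
  where
    split : ∀ {b c d} → (T b → T (c ∨ d)) → (T c → ¬ T d) → b ∧ not c ≡ d ∧ b
    split {false} {d = d} _ _ = sym (∧-zeroʳ d)
    split {true} {false} {false} b⇒c∨d _ = ⊥-elim (b⇒c∨d _)
    split {true} {false} {true}  _ _ = refl
    split {true} {true}  {false} _ _ = refl
    split {true} {true}  {true}  _ c⇒¬d = ⊥-elim (c⇒¬d _ _)

count-permute : ∀ {n} (σ σ⁻¹ : Fin n → Fin n) → (∀ y → σ (σ⁻¹ y) ≡ y) → (∀ x → σ⁻¹ (σ x) ≡ x) →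
                (A : Fin n → Bool) → count (A ∘ σ) ≡ count A
count-permute σ σ⁻¹ inv₁ inv₂ A = sym (sum-permute (boolToℕ ∘ A) (permutation σ σ⁻¹ inv₁ inv₂))

module Involution {n} (ι : Fin n → Fin n) (ι-involutive : ∀ x → ι (ι x) ≡ x) where

  Closed : (Fin n → Bool) → Set
  Closed A = ∀ x → A (ι x) ≡ A x

  HasFixedPoint : (Fin n → Bool) → Set
  HasFixedPoint A = ∃ λ x → T (A x) × ι x ≡ x

  record ClosedSubsetOfSize (A : Fin n → Bool) (k : ℕ) : Set where
    field
      elements        : Fin n → Bool
      elements⊆       : elements ⊆ A
      elements-closed : Closed elements
      count-elements  : count elements ≡ k

  ∅-closedSubset : ∀ {A} → ClosedSubsetOfSize A 0
  ∅-closedSubset = record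
    { elements = λ _ → false ; elements⊆ = λ _ () ; elements-closed = λ _ → refl ; count-elements = count-∅ n }

  ∖-closed : ∀ {A B} → Closed A → Closed B → Closed (A ∖ B)
  ∖-closed A-closed B-closed x = cong₂ (λ a b → a ∧ not b) (A-closed x) (B-closed x)

  ∩-closed : ∀ {A B} → Closed A → Closed B → Closed (A ∩ B)
  ∩-closed A-closed B-closed x = cong₂ _∧_ (A-closed x) (B-closed x)

  ∪-closed : ∀ {A B} → Closed A → Closed B → Closed (A ∪ B)
  ∪-closed A-closed B-closed x = cong₂ _∨_ (A-closed x) (B-closed x)

  orbit : Fin n → (Fin n → Bool)
  orbit a = ⁅ a ⁆ ∪ ⁅ ι a ⁆

  orbit-refl : ∀ a → T (orbit a a)
  orbit-refl a = Equivalence.from T-∨ (inj₁ (subst T (sym (dec-true (a ≟ a) refl)) _))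

  ⁅⁆-ι : ∀ a x → ⁅ a ⁆ (ι x) ≡ ⁅ ι a ⁆ x
  ⁅⁆-ι a x = does-⇔ (mk⇔ (λ ιx≡a → trans (sym (ι-involutive x)) (cong ι ιx≡a))
                          (λ x≡ιa → trans (cong ι x≡ιa) (ι-involutive a)))
                    (ι x ≟ a) (x ≟ ι a)

  orbit-closed : ∀ a → Closed (orbit a)
  orbit-closed a x = begin
    ⁅ a ⁆ (ι x) ∨ ⁅ ι a ⁆ (ι x)   ≡⟨ cong₂ _∨_ (⁅⁆-ι a x) (⁅⁆-ι (ι a) x) ⟩
    ⁅ ι a ⁆ x ∨ ⁅ ι (ι a) ⁆ x     ≡⟨ cong (λ b → ⁅ ι a ⁆ x ∨ ⁅ b ⁆ x) (ι-involutive a) ⟩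
    ⁅ ι a ⁆ x ∨ ⁅ a ⁆ x           ≡⟨ ∨-comm (⁅ ι a ⁆ x) _ ⟩
    orbit a x                     ∎
    where open ≡-Reasoning

  orbit⊆ : ∀ {A a} → Closed A → T (A a) → orbit a ⊆ A
  orbit⊆ {A} {a} A-closed a∈A x x∈orbit with Equivalence.to (T-∨ {⁅ a ⁆ x}) x∈orbit
  ... | inj₁ x≡a  rewrite T-does⇒ (x ≟ a) x≡a = a∈A
  ... | inj₂ x≡ιa rewrite T-does⇒ (x ≟ ι a) x≡ιa | A-closed a = a∈A

  count-orbit-fixed : ∀ {a} → ι a ≡ a → count (orbit a) ≡ 1
  count-orbit-fixed {a} ιa≡a =
    trans (count-cong λ x → trans (cong (λ b → ⁅ a ⁆ x ∨ ⁅ b ⁆ x) ιa≡a) (∨-idem _)) (count-⁅⁆ a)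

  count-orbit-moved : ∀ {a} → ι a ≢ a → count (orbit a) ≡ 2
  count-orbit-moved {a} ιa≢a = trans (count-∪ ⁅ a ⁆ ⁅ ι a ⁆ disjoint) (cong₂ _+_ (count-⁅⁆ a) (count-⁅⁆ (ι a)))
    where
      disjoint : ∀ x → T (⁅ a ⁆ x) → ¬ T (⁅ ι a ⁆ x)
      disjoint x x≡a x≡ιa = ιa≢a (trans (sym (T-does⇒ (x ≟ ι a) x≡ιa)) (T-does⇒ (x ≟ a) x≡a))

  count-without-orbit : ∀ {A a} → Closed A → T (A a) → count A ≡ count (orbit a) + count (A ∖ orbit a)
  count-without-orbit {A} {a} A-closed a∈A =
    trans (count-partition A (orbit a)) (cong (_+ count (A ∖ orbit a)) (count-∩-⊆ A (orbit a) (orbit⊆ A-closed a∈A)))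

  add-orbit : ∀ {A a k} → Closed A → T (A a) →
              ClosedSubsetOfSize (A ∖ orbit a) k → ClosedSubsetOfSize A (count (orbit a) + k)
  add-orbit {A} {a} A-closed a∈A B = record
    { elements        = orbit a ∪ elements
    ; elements⊆       = ∪-⊆ (orbit a) elements (orbit⊆ A-closed a∈A) (λ x → ∖-⊆ A (orbit a) x ∘ elements⊆ x)
    ; elements-closed = ∪-closed (orbit-closed a) elements-closed
    ; count-elements  = trans (count-∪ (orbit a) elements disjoint) (cong (count (orbit a) +_) count-elements)
    }
    where
      open ClosedSubsetOfSize B
      disjoint : ∀ x → T (orbit a x) → ¬ T (elements x)
      disjoint x x∈orbit x∈B = ∖-disjoint A (orbit a) (elements⊆ x x∈B) x∈orbit

  count-without-moved-orbit : ∀ {A a} → Closed A → T (A a) → ι a ≢ a → count A ≡ 2 + count (A ∖ orbit a)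
  count-without-moved-orbit {A} {a} A-closed a∈A ιa≢a =
    trans (count-without-orbit A-closed a∈A) (cong (_+ count (A ∖ orbit a)) (count-orbit-moved ιa≢a))

  count-without-fixed-orbit : ∀ {A a} → Closed A → T (A a) → ι a ≡ a → count A ≡ 1 + count (A ∖ orbit a)
  count-without-fixed-orbit {A} {a} A-closed a∈A ιa≡a =
    trans (count-without-orbit A-closed a∈A) (cong (_+ count (A ∖ orbit a)) (count-orbit-fixed ιa≡a))

  fixedPoint-∉-orbit : ∀ {a b} → ι a ≢ a → ι b ≡ b → ¬ T (orbit a b)
  fixedPoint-∉-orbit {a} {b} ιa≢a ιb≡b b∈orbit with Equivalence.to (T-∨ {⁅ a ⁆ b}) b∈orbit
  ... | inj₁ b≡a  = ιa≢a (subst (λ c → ι c ≡ c) (T-does⇒ (b ≟ a) b≡a) ιb≡b)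
  ... | inj₂ b≡ιa = ιa≢a (trans (sym b≡ιa′) (trans (sym ιb≡b) (trans (cong ι b≡ιa′) (ι-involutive a))))
    where b≡ιa′ = T-does⇒ (b ≟ ι a) b≡ιa

  count-even : ∀ m {A} → count A ≡ m → Closed A → ¬ HasFixedPoint A → 2 ∣ m
  count-even zero    _ _ _ = 2 ∣0
  count-even (suc m) {A} count≡ A-closed no-fixed with count-nonempty A (subst (0 <_) (sym count≡) (s≤s z≤n))
  ... | a , a∈A = step m (trans (sym count≡) (count-without-moved-orbit A-closed a∈A moved))
    where
      moved : ι a ≢ a
      moved ιa≡a = no-fixed (a , a∈A , ιa≡a)
      step : ∀ m → suc m ≡ 2 + count (A ∖ orbit a) → 2 ∣ suc m
      step (suc m) eq = ∣m∣n⇒∣m+n ∣-refl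
        (count-even m (sym (suc-injective (suc-injective eq)))
          (∖-closed A-closed (orbit-closed a))
          (λ (x , x∈A′ , fixed) → no-fixed (x , ∖-⊆ A (orbit a) x x∈A′ , fixed)))

  odd⇒fixedPoint : ∀ {A} → Closed A → ¬ 2 ∣ count A → HasFixedPoint A
  odd⇒fixedPoint {A} A-closed odd with any? (λ x → T? (A x) ×-dec (ι x ≟ x))
  ... | yes fixed = fixed
  ... | no  none  = contradiction (count-even (count A) refl A-closed none) odd

  ClosedSubsetExists : ℕ → Set
  ClosedSubsetExists k = ∀ {A} → Closed A → k ≤ count A → 2 ∣ k ⊎ HasFixedPoint A → ClosedSubsetOfSize A k

  closedSubsetExists-0 : ClosedSubsetExists 0
  closedSubsetExists-0 _ _ _ = ∅-closedSubset

  closedSubsetExists-1 : ClosedSubsetExists 1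
  closedSubsetExists-1 _ _ (inj₁ 2∣1) = contradiction 2∣1 ¬2∣1
  closedSubsetExists-1 {A} A-closed _ (inj₂ (a , a∈A , ιa≡a)) =
    subst (ClosedSubsetOfSize A) (cong (_+ 0) (count-orbit-fixed ιa≡a)) (add-orbit A-closed a∈A ∅-closedSubset)

  -- Remove the orbit of a moved point if there is one, and otherwise a single fixed point.
  closedSubsetExists-+2 : ∀ {k} → ClosedSubsetExists k → ClosedSubsetExists (suc k) → ClosedSubsetExists (suc (suc k))
  closedSubsetExists-+2 {k} ih ih+1 {A} A-closed k+2≤ parity with any? (λ x → T? (A x) ×-dec ¬? (ι x ≟ x))
  ... | yes (a , a∈A , moved) =
    subst (ClosedSubsetOfSize A) (cong (_+ k) (count-orbit-moved moved))
      (add-orbit A-closed a∈A (ih (∖-closed A-closed (orbit-closed a)) k≤ parity′))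
    where
      k≤ : k ≤ count (A ∖ orbit a)
      k≤ = s≤s⁻¹ (s≤s⁻¹ (subst (suc (suc k) ≤_) (count-without-moved-orbit A-closed a∈A moved) k+2≤))
      parity′ : 2 ∣ k ⊎ HasFixedPoint (A ∖ orbit a)
      parity′ = Sum.map (λ 2∣k+2 → ∣m+n∣m⇒∣n 2∣k+2 ∣-refl)
                        (λ (b , b∈A , ιb≡b) → b , ∖-∈ A (orbit a) b∈A (fixedPoint-∉-orbit moved ιb≡b) , ιb≡b)
                        parity
  ... | no ∄moved = remove-fixed (count-nonempty A (≤-trans (s≤s z≤n) k+2≤))
    where
      fixed : ∀ {x} → T (A x) → ι x ≡ x
      fixed {x} x∈A = decidable-stable (ι x ≟ x) (λ moved → ∄moved (x , x∈A , moved))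
      remove-fixed : ∃ (T ∘ A) → ClosedSubsetOfSize A (suc (suc k))
      remove-fixed (a , a∈A) =
        let k+1≤ = s≤s⁻¹ (subst (suc (suc k) ≤_) (count-without-fixed-orbit A-closed a∈A (fixed a∈A)) k+2≤)
            b , b∈A′ = count-nonempty (A ∖ orbit a) (≤-trans (s≤s z≤n) k+1≤)
        in subst (ClosedSubsetOfSize A) (cong (_+ suc k) (count-orbit-fixed (fixed a∈A)))
             (add-orbit A-closed a∈A (ih+1 (∖-closed A-closed (orbit-closed a)) k+1≤
               (inj₂ (b , b∈A′ , fixed (∖-⊆ A (orbit a) b b∈A′)))))

  closedSubsetOfSize : ∀ k → ClosedSubsetExists k
  closedSubsetOfSize zero          = closedSubsetExists-0
  closedSubsetOfSize (suc zero)    = closedSubsetExists-1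
  closedSubsetOfSize (suc (suc k)) = closedSubsetExists-+2 (closedSubsetOfSize k) (closedSubsetOfSize (suc k))

first : ∀ {n} → (Fin n → Bool) → Maybe (Fin n)
first {zero}  A = nothing
first {suc n} A = if A zero then just zero else Maybe.map suc (first (A ∘ suc))

first-cong : ∀ {n} {A B : Fin n → Bool} → (∀ x → A x ≡ B x) → first A ≡ first B
first-cong {zero}  _   = refl
first-cong {suc n} A≗B = cong₂ (λ b m → if b then just zero else Maybe.map suc m) (A≗B zero) (first-cong (A≗B ∘ suc))

first-sound : ∀ {n} (A : Fin n → Bool) {a} → first A ≡ just a → T (A a)
first-sound {suc n} A eq with A zero in A0
first-sound {suc n} A refl | true = subst T (sym A0) _
... | false with first (A ∘ suc) in eq′
first-sound {suc n} A refl | false | just a = first-sound (A ∘ suc) eq′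

first-complete : ∀ {n} (A : Fin n → Bool) {a} → T (A a) → first A ≢ nothing
first-complete {suc n} A {a} a∈A eq with A zero in A0
first-complete {suc n} A {a} a∈A () | true
... | false with first (A ∘ suc) in eq′
first-complete {suc n} A {zero} a∈A eq | false | nothing = subst T A0 a∈A
first-complete {suc n} A {suc a} a∈A eq | false | nothing = first-complete (A ∘ suc) a∈A eq′

module Representatives {n} (class : Fin n → Fin n → Bool) (class-refl : ∀ c → T (class c c))
                       (class-move : ∀ {c x} → T (class c x) → ∀ y → class x y ≡ class c y) where

  rep : Fin n → Fin n
  rep c = fromMaybe c (first (class c))

  rep-member : ∀ c → T (class c (rep c))
  rep-member c with first (class c) in eq
  ... | just r  = first-sound (class c) eq
  ... | nothing = class-refl c

  rep-cong : ∀ {c x} → T (class c x) → rep x ≡ rep c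
  rep-cong {c} {x} x∈c rewrite first-cong (class-move x∈c) with first (class c) in eq
  ... | just r  = refl
  ... | nothing = contradiction eq (first-complete (class c) (class-refl c))

module NormalSubgroup (G : FiniteGroup) (H : Subset (FiniteGroup.order G)) (N : IsNormalSubgroup G H) where
  open FiniteGroup G renaming (_∙_ to infixl 7 _∙_; _⁻¹ to infix 8 _⁻¹)
  open IsGroup isGroup using (assoc; identityʳ; inverseˡ)
  open IsNormalSubgroup N

  group : Group 0ℓ 0ℓ
  group = record { isGroup = isGroup }

  open GroupProperties group using (ε⁻¹≈ε; ⁻¹-involutive; ⁻¹-anti-homo-∙; \\-leftDividesˡ; \\-leftDividesʳ; //-rightDividesʳ)
  open Involution _⁻¹ ⁻¹-involutive

  inH : Elt G → Bool
  inH = lookup H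

  ε∈H : T (inH ε)
  ε∈H = T-lookup ε∈

  ∙∈H : ∀ {a b} → T (inH a) → T (inH b) → T (inH (a ∙ b))
  ∙∈H a∈H b∈H = T-lookup (∙-closed (lookup-∈ a∈H) (lookup-∈ b∈H))

  ⁻¹∈H : ∀ {a} → T (inH a) → T (inH (a ⁻¹))
  ⁻¹∈H = T-lookup ∘ ⁻¹-closed ∘ lookup-∈

  inH-⁻¹ : ∀ a → inH (a ⁻¹) ≡ inH a
  inH-⁻¹ a = T-antisym (subst (T ∘ inH) (⁻¹-involutive a) ∘ ⁻¹∈H) ⁻¹∈H

  inH-∙ˡ : ∀ {u} v → T (inH u) → inH (u ∙ v) ≡ inH v
  inH-∙ˡ {u} v u∈H =
    T-antisym (subst (T ∘ inH) (\\-leftDividesʳ u v) ∘ ∙∈H (⁻¹∈H u∈H)) (∙∈H u∈H)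

  inH-comm : ∀ a b → inH (a ∙ b) ≡ inH (b ∙ a)
  inH-comm a b = T-antisym (conj-swap a b) (conj-swap b a)
    where
      conj-swap : ∀ a b → T (inH (a ∙ b)) → T (inH (b ∙ a))
      conj-swap a b ab∈H = subst (T ∘ inH) (trans (cong (_∙ b ⁻¹) (sym (assoc b a b))) (//-rightDividesʳ b (b ∙ a)))
                                 (T-lookup (conj-closed b (lookup-∈ ab∈H)))

  coset : Elt G → Elt G → Bool
  coset c x = inH (c ⁻¹ ∙ x)

  coset-refl : ∀ c → T (coset c c)
  coset-refl c = subst (T ∘ inH) (sym (inverseˡ c)) ε∈H

  coset-ε : ∀ c → coset c ε ≡ inH c
  coset-ε c = trans (cong inH (identityʳ (c ⁻¹))) (inH-⁻¹ c)

  coset-∈H : ∀ {c} → T (inH c) → ∀ x → coset c x ≡ inH x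
  coset-∈H c∈H x = inH-∙ˡ x (⁻¹∈H c∈H)

  coset-move : ∀ {c x} → T (coset c x) → ∀ y → coset x y ≡ coset c y
  coset-move {c} {x} x∈cH y = trans (cong inH (sym regroup)) (inH-∙ˡ (c ⁻¹ ∙ y) x⁻¹c∈H)
    where
      regroup : x ⁻¹ ∙ c ∙ (c ⁻¹ ∙ y) ≡ x ⁻¹ ∙ y
      regroup = trans (assoc (x ⁻¹) c (c ⁻¹ ∙ y)) (cong (x ⁻¹ ∙_) (\\-leftDividesˡ c y))
      x⁻¹c∈H : T (inH (x ⁻¹ ∙ c))
      x⁻¹c∈H = subst (T ∘ inH) (trans (⁻¹-anti-homo-∙ (c ⁻¹) x) (cong (x ⁻¹ ∙_) (⁻¹-involutive c))) (⁻¹∈H x∈cH)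

  coset-⁻¹ : ∀ c x → coset c (x ⁻¹) ≡ coset (c ⁻¹) x
  coset-⁻¹ c x = begin
    inH (c ⁻¹ ∙ x ⁻¹)     ≡⟨ cong inH (⁻¹-anti-homo-∙ x c) ⟨
    inH ((x ∙ c) ⁻¹)      ≡⟨ inH-⁻¹ (x ∙ c) ⟩
    inH (x ∙ c)           ≡⟨ inH-comm x c ⟩
    inH (c ∙ x)           ≡⟨ cong (λ d → inH (d ∙ x)) (⁻¹-involutive c) ⟨
    inH (c ⁻¹ ⁻¹ ∙ x)     ∎
    where open ≡-Reasoning

  coset-⁻¹-self : ∀ c → coset c (c ⁻¹) ≡ inH (c ∙ c)
  coset-⁻¹-self c = trans (coset-⁻¹ c c) (cong (λ d → inH (d ∙ c)) (⁻¹-involutive c))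

  coset-⁻¹-square : ∀ {c} → T (inH (c ∙ c)) → ∀ x → coset (c ⁻¹) x ≡ coset c x
  coset-⁻¹-square {c} cc∈H = coset-move (subst T (sym (coset-⁻¹-self c)) cc∈H)

  coset-disjoint : ∀ {c} → ¬ T (inH (c ∙ c)) → ∀ x → T (coset c x) → ¬ T (coset (c ⁻¹) x)
  coset-disjoint {c} cc∉H x x∈cH x∈c⁻¹H = cc∉H (subst T (coset-⁻¹-self c)
    (subst T (trans (sym (coset-move x∈c⁻¹H (c ⁻¹))) (coset-move x∈cH (c ⁻¹))) (coset-refl (c ⁻¹))))

  count-coset : ∀ c → count (coset c) ≡ ∣ H ∣
  count-coset c = trans (count-permute (c ⁻¹ ∙_) (c ∙_) (\\-leftDividesʳ c) (\\-leftDividesˡ c) inH) (sym (∣p∣≡count H))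

  count-coset-⁻¹ : ∀ {S} → Closed S → ∀ c → count (coset (c ⁻¹) ∩ S) ≡ count (coset c ∩ S)
  count-coset-⁻¹ {S} S-closed c =
    trans (count-cong λ x → sym (cong₂ _∧_ (coset-⁻¹ c x) (S-closed x)))
          (count-permute _⁻¹ _⁻¹ ⁻¹-involutive ⁻¹-involutive (coset c ∩ S))

  cosetPair : Elt G → Elt G → Bool
  cosetPair c = coset c ∪ coset (c ⁻¹)

  cosetPair-refl : ∀ c → T (cosetPair c c)
  cosetPair-refl c = Equivalence.from T-∨ (inj₁ (coset-refl c))

  cosetPair-closed : ∀ c → Closed (cosetPair c)
  cosetPair-closed c x = begin
    coset c (x ⁻¹) ∨ coset (c ⁻¹) (x ⁻¹)    ≡⟨ cong₂ _∨_ (coset-⁻¹ c x) (coset-⁻¹ (c ⁻¹) x) ⟩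
    coset (c ⁻¹) x ∨ coset (c ⁻¹ ⁻¹) x      ≡⟨ cong (λ d → coset (c ⁻¹) x ∨ coset d x) (⁻¹-involutive c) ⟩
    coset (c ⁻¹) x ∨ coset c x              ≡⟨ ∨-comm (coset (c ⁻¹) x) _ ⟩
    cosetPair c x                           ∎
    where open ≡-Reasoning

  cosetPair-cases : ∀ {c z} → T (cosetPair c z) →
                    (∀ y → coset z y ≡ coset c y) ⊎ (∀ y → coset z y ≡ coset (c ⁻¹) y)
  cosetPair-cases {c} {z} = Sum.map coset-move coset-move ∘ Equivalence.to (T-∨ {coset c z})

  coset-cong-⁻¹ : ∀ {c x} → (∀ y → coset x y ≡ coset c y) → ∀ y → coset (x ⁻¹) y ≡ coset (c ⁻¹) y
  coset-cong-⁻¹ {c} {x} x≈c y = trans (sym (coset-⁻¹ x y)) (trans (x≈c (y ⁻¹)) (coset-⁻¹ c y))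

  cosetPair-move : ∀ {c x} → T (cosetPair c x) → ∀ y → cosetPair x y ≡ cosetPair c y
  cosetPair-move {c} {x} x∈cH∪c⁻¹H y with cosetPair-cases x∈cH∪c⁻¹H
  ... | inj₁ x≈c   = cong₂ _∨_ (x≈c y) (coset-cong-⁻¹ x≈c y)
  ... | inj₂ x≈c⁻¹ = trans (cong₂ _∨_ (x≈c⁻¹ y) (trans (coset-cong-⁻¹ x≈c⁻¹ y) (cong (λ d → coset d y) (⁻¹-involutive c))))
                           (∨-comm (coset (c ⁻¹) y) _)

  inH-cosetPair : ∀ {c z} → T (cosetPair c z) → inH z ≡ inH c
  inH-cosetPair {c} {z} z∈cH∪c⁻¹H with cosetPair-cases z∈cH∪c⁻¹H
  ... | inj₁ z≈c   = trans (sym (coset-ε z)) (trans (z≈c ε) (coset-ε c))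
  ... | inj₂ z≈c⁻¹ = trans (sym (coset-ε z)) (trans (z≈c⁻¹ ε) (trans (coset-ε (c ⁻¹)) (inH-⁻¹ c)))

  count-nbhd : ∀ X g → ∣ H Subset.∩ nbhd G X g ∣ ≡ count (coset (g ⁻¹) ∩ lookup X)
  count-nbhd X g = begin
    ∣ H Subset.∩ nbhd G X g ∣                          ≡⟨ ∣p∣≡count (H Subset.∩ nbhd G X g) ⟩
    count (lookup (H Subset.∩ nbhd G X g))             ≡⟨ count-cong unfold ⟩
    count (λ y → inH y ∧ lookup X (g ⁻¹ ∙ y))          ≡⟨ count-permute (g ∙_) (g ⁻¹ ∙_) (\\-leftDividesˡ g) (\\-leftDividesʳ g) _ ⟨
    count (λ x → inH (g ∙ x) ∧ lookup X (g ⁻¹ ∙ (g ∙ x))) ≡⟨ count-cong refold ⟩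
    count (coset (g ⁻¹) ∩ lookup X)                    ∎
    where
      open ≡-Reasoning
      unfold : ∀ y → lookup (H Subset.∩ nbhd G X g) y ≡ inH y ∧ lookup X (g ⁻¹ ∙ y)
      unfold y = trans (lookup-zipWith _∧_ y H (nbhd G X g)) (cong (inH y ∧_) (lookup∘tabulate _ y))
      refold : ∀ x → inH (g ∙ x) ∧ lookup X (g ⁻¹ ∙ (g ∙ x)) ≡ coset (g ⁻¹) x ∧ lookup X x
      refold x = cong₂ _∧_ (cong (λ d → inH (d ∙ x)) (sym (⁻¹-involutive g))) (cong (lookup X) (\\-leftDividesʳ g x))

  -- Fixed points are those of inversion, i.e. involutions, as 1 ∉ r H.
  CosetInvolutionCondition : Set
  CosetInvolutionCondition = ∀ r → ¬ T (inH r) → T (inH (r ∙ r)) → HasFixedPoint (coset r)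

  coset-closed : ∀ {r} → T (inH (r ∙ r)) → Closed (coset r)
  coset-closed {r} rr∈H x = trans (coset-⁻¹ r x) (coset-⁻¹-square rr∈H x)

  connectionSet-closed : ∀ {X} → IsConnectionSet G X → Closed (lookup X)
  connectionSet-closed {X} X-conn x =
    T-antisym (subst (T ∘ lookup X) (⁻¹-involutive x) ∘ T-lookup ∘ inv-closed ∘ lookup-∈)
              (T-lookup ∘ inv-closed ∘ lookup-∈)
    where open IsConnectionSet X-conn

  regular⇒cosetInvolutionCondition : ∀ {κ τ} → ¬ 2 ∣ τ → IsRegularSet G κ τ H → CosetInvolutionCondition
  regular⇒cosetInvolutionCondition {τ = τ} τ-odd (X , X-conn , X-regular) r r∉H rr∈H
    with odd⇒fixedPoint (∩-closed (coset-closed rr∈H) (connectionSet-closed X-conn)) (τ-odd ∘ subst (2 ∣_) count≡τ)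
    where
      count≡τ : count (coset r ∩ lookup X) ≡ τ
      count≡τ = begin
        count (coset r ∩ lookup X)           ≡⟨ count-cong (λ x → cong (λ d → coset d x ∧ lookup X x) (⁻¹-involutive r)) ⟨
        count (coset (r ⁻¹ ⁻¹) ∩ lookup X)   ≡⟨ count-nbhd X (r ⁻¹) ⟨
        ∣ H Subset.∩ nbhd G X (r ⁻¹) ∣      ≡⟨ proj₂ (X-regular (r ⁻¹)) (r∉H ∘ subst T (inH-⁻¹ r) ∘ T-lookup) ⟩
        τ                                   ∎
        where open ≡-Reasoning
  ... | x , x∈S , x⁻¹≡x = x , proj₁ (Equivalence.to (T-∧ {coset r x}) x∈S) , x⁻¹≡x

  module Construction (κ τ : ℕ) (κ≤ : κ ≤ ∣ H ∣ ∸ 1) (τ≤ : τ ≤ ∣ H ∣)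
                      (κ-parity : 2 ∣ ∣ H ∣ ∸ 1 → 2 ∣ κ) (τ-parity : 2 ∣ τ ⊎ CosetInvolutionCondition) where

    valency : Elt G → ℕ
    valency r = if inH r then κ else τ

    valency-∈H : ∀ {r} → T (inH r) → valency r ≡ κ
    valency-∈H r∈H = cong (if_then κ else τ) (Equivalence.to T-≡ r∈H)

    valency-∉H : ∀ {r} → ¬ T (inH r) → valency r ≡ τ
    valency-∉H r∉H = cong (if_then κ else τ) (¬T⇒≡false r∉H)

    record Block (r : Elt G) : Set where
      field
        members        : Elt G → Bool
        members-closed : Closed members
        ε∉members      : ¬ T (members ε)
        count-members  : count (coset r ∩ members) ≡ valency r

    block-∈H : ∀ {r} → T (inH r) → Block r
    block-∈H {r} r∈H = record
      { members        = elements
      ; members-closed = elements-closed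
      ; ε∉members      = λ ε∈B → ∖-disjoint inH (orbit ε) (elements⊆ ε ε∈B) (orbit-refl ε)
      ; count-members  = begin
          count (coset r ∩ elements) ≡⟨ count-cong (λ x → cong (_∧ elements x) (coset-∈H r∈H x)) ⟩
          count (inH ∩ elements)     ≡⟨ count-∩-⊆ inH elements (λ x → ∖-⊆ inH (orbit ε) x ∘ elements⊆ x) ⟩
          count elements             ≡⟨ count-elements ⟩
          κ                          ≡⟨ valency-∈H r∈H ⟨
          valency r                  ∎
      }
      where
        open ≡-Reasoning
        A = inH ∖ orbit ε
        A-closed : Closed A
        A-closed = ∖-closed inH-⁻¹ (orbit-closed ε)
        count-A : count A ≡ ∣ H ∣ ∸ 1
        count-A = sym (cong (_∸ 1) (trans (∣p∣≡count H) (count-without-fixed-orbit inH-⁻¹ ε∈H ε⁻¹≈ε)))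
        parity : 2 ∣ κ ⊎ HasFixedPoint A
        parity with 2 ∣? count A
        ... | yes even = inj₁ (κ-parity (subst (2 ∣_) count-A even))
        ... | no  odd  = inj₂ (odd⇒fixedPoint A-closed odd)
        open ClosedSubsetOfSize (closedSubsetOfSize κ A-closed (subst (κ ≤_) (sym count-A) κ≤) parity)

    block-selfInverse : ∀ {r} → ¬ T (inH r) → T (inH (r ∙ r)) → Block r
    block-selfInverse {r} r∉H rr∈H = record
      { members        = elements
      ; members-closed = elements-closed
      ; ε∉members      = λ ε∈B → r∉H (subst T (coset-ε r) (elements⊆ ε ε∈B))
      ; count-members  = trans (count-∩-⊆ (coset r) elements elements⊆) (trans count-elements (sym (valency-∉H r∉H)))
      }
      where
        parity : 2 ∣ τ ⊎ HasFixedPoint (coset r)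
        parity = Sum.map₂ (λ condition → condition r r∉H rr∈H) τ-parity
        open ClosedSubsetOfSize
          (closedSubsetOfSize τ (coset-closed rr∈H) (subst (τ ≤_) (sym (count-coset r)) τ≤) parity)

    block-paired : ∀ {r} → ¬ T (inH (r ∙ r)) → Block r
    block-paired {r} rr∉H = record
      { members        = elements
      ; members-closed = elements-closed
      ; ε∉members      = λ ε∈B → rr∉H (let r∈H = subst T (inH-cosetPair (elements⊆ ε ε∈B)) ε∈H in ∙∈H r∈H r∈H)
      ; count-members  = trans (*-cancelˡ-≡ _ τ 2 (trans (sym count-halves) count-elements))
                               (sym (valency-∉H (λ r∈H → rr∉H (∙∈H r∈H r∈H))))
      }
      where
        count-pair : count (cosetPair r) ≡ 2 * ∣ H ∣
        count-pair = trans (count-∪ (coset r) (coset (r ⁻¹)) (coset-disjoint rr∉H))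
                           (cong₂ _+_ (count-coset r) (trans (count-coset (r ⁻¹)) (sym (+-identityʳ ∣ H ∣))))
        open ClosedSubsetOfSize
          (closedSubsetOfSize (2 * τ) (cosetPair-closed r) (subst (2 * τ ≤_) (sym count-pair) (*-monoʳ-≤ 2 τ≤))
                              (inj₁ (m∣m*n τ)))
        count-halves : count elements ≡ 2 * count (coset r ∩ elements)
        count-halves =
          trans (count-⊆-∪ elements (coset r) (coset (r ⁻¹)) elements⊆ (coset-disjoint rr∉H))
                (cong (count (coset r ∩ elements) +_)
                      (trans (count-coset-⁻¹ elements-closed r) (sym (+-identityʳ _))))

    block : ∀ r → Block r
    block r with T? (inH r) | T? (inH (r ∙ r))
    ... | yes r∈H | _         = block-∈H r∈H
    ... | no  r∉H | yes rr∈H  = block-selfInverse r∉H rr∈H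
    ... | no  _   | no  rr∉H  = block-paired rr∉H

    open Representatives cosetPair cosetPair-refl cosetPair-move

    connection : Elt G → Bool
    connection x = Block.members (block (rep x)) x

    connection-closed : Closed connection
    connection-closed x =
      trans (cong (λ c → Block.members (block c) (x ⁻¹)) (rep-cong (Equivalence.from T-∨ (inj₂ (coset-refl (x ⁻¹))))))
            (Block.members-closed (block (rep x)) x)

    count-connection : ∀ c → count (coset c ∩ connection) ≡ valency c
    count-connection c = begin
      count (coset c ∩ connection)   ≡⟨ count-cong (λ x → ∧-congˡ-T (λ x∈cH →
                                          cong (λ d → members d x) (rep-cong (Equivalence.from T-∨ (inj₁ x∈cH))))) ⟩
      count (coset c ∩ members r)    ≡⟨ count-on-pair (cosetPair-cases c∈pair) ⟩
      valency r                      ≡⟨ cong (if_then κ else τ) (inH-cosetPair c∈pair) ⟨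
      valency c                      ∎
      where
        open ≡-Reasoning
        members = Block.members ∘ block
        r = rep c
        c∈pair : T (cosetPair r c)
        c∈pair = subst T (sym (cosetPair-move (rep-member c) c)) (cosetPair-refl c)
        count-on-pair : (∀ y → coset c y ≡ coset r y) ⊎ (∀ y → coset c y ≡ coset (r ⁻¹) y) →
                        count (coset c ∩ members r) ≡ valency r
        count-on-pair (inj₁ c≈r)   = trans (count-cong λ x → cong (_∧ members r x) (c≈r x)) (Block.count-members (block r))
        count-on-pair (inj₂ c≈r⁻¹) = trans (count-cong λ x → cong (_∧ members r x) (c≈r⁻¹ x))
                                     (trans (count-coset-⁻¹ (Block.members-closed (block r)) r) (Block.count-members (block r)))

    isRegularSet : IsRegularSet G κ τ H
    isRegularSet = X , X-conn , λ g → (λ g∈H → trans (count-X g) (valency-∈H (T-lookup g∈H)))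
                                    , (λ g∉H → trans (count-X g) (valency-∉H (g∉H ∘ lookup-∈)))
      where
        X = tabulate connection
        X-conn : IsConnectionSet G X
        X-conn = record
          { ε∉X        = Block.ε∉members (block (rep ε)) ∘ ∈-tabulate
          ; inv-closed = λ {x} → tabulate-∈ ∘ subst T (sym (connection-closed x)) ∘ ∈-tabulate
          }
        count-X : ∀ g → ∣ H Subset.∩ nbhd G X g ∣ ≡ valency g
        count-X g = begin
          ∣ H Subset.∩ nbhd G X g ∣        ≡⟨ count-nbhd X g ⟩
          count (coset (g ⁻¹) ∩ lookup X)  ≡⟨ count-cong (λ x → cong (coset (g ⁻¹) x ∧_) (lookup∘tabulate connection x)) ⟩
          count (coset (g ⁻¹) ∩ connection) ≡⟨ count-connection (g ⁻¹) ⟩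
          valency (g ⁻¹)                   ≡⟨ cong (if_then κ else τ) (inH-⁻¹ g) ⟩
          valency g                        ∎
          where open ≡-Reasoning

theorem1p1 : (G : FiniteGroup) (H : Subset (FiniteGroup.order G)) →
    IsNormalSubgroup G H → NonTrivial G H →
    (κ τ : ℕ) → κ ≤ ∣ H ∣ ∸ 1 → 1 ≤ τ → τ ≤ ∣ H ∣ →
    gcd 2 (∣ H ∣ ∸ 1) ∣ κ →
    (2 ∣ τ → IsRegularSet G κ τ H) ×
    (¬ (2 ∣ τ) → (IsRegularSet G κ τ H ⇔ IsPerfectCode G H))
theorem1p1 G H N _ κ τ κ≤ 1≤τ τ≤ gcd∣κ =
    (λ τ-even → regular (inj₁ τ-even))
  , λ τ-odd → mk⇔
      (λ κτ-regular → perfectCode (regular⇒cosetInvolutionCondition τ-odd κτ-regular))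
      (λ perfect → regular (inj₂ (regular⇒cosetInvolutionCondition ¬2∣1 perfect)))
  where
    open NormalSubgroup G H N
    κ-parity : 2 ∣ ∣ H ∣ ∸ 1 → 2 ∣ κ
    κ-parity 2∣∣H∣-1 = ∣-trans (gcd-greatest ∣-refl 2∣∣H∣-1) gcd∣κ
    regular : 2 ∣ τ ⊎ CosetInvolutionCondition → IsRegularSet G κ τ H
    regular = Construction.isRegularSet κ τ κ≤ τ≤ κ-parity
    perfectCode : CosetInvolutionCondition → IsPerfectCode G H
    perfectCode = Construction.isRegularSet 0 1 z≤n (≤-trans 1≤τ τ≤) (λ _ → 2 ∣0) ∘ inj₂
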